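{- For every instance $p_1\ge\dots\ge p_n>0$ of the triangle scheduling problem, the makespan of the schedule produced by the Greedy algorithm is at most $\frac32\,\mathrm{OPT}$, where $\mathrm{OPT}$ is the optimal makespan. That is, Greedy has approximation ratio at most $1.5$.
   Context: Triangle scheduling problem (TS): given integers $p_1\ge \dots\ge p_n>0$, a feasible schedule is a choice of starting times $s_1,\dots,s_n\ge 0$ such that for all $i\ne j$, $|s_i-s_j|\ge \min\{p_i,p_j\}$; its makespan is $\max_j (s_j+p_j)$, and $\mathrm{OPT}$ is the minimum makespan. For a (partial) schedule, a gap is any interval between two successive starting times, together with the interval from the largest starting time to the makespan. Greedy algorithm: set $s_1=0$. Then for $j=2,\dots,n$ in order, choose a gap of largest length among the current gaps (the first one, i.e. leftmost, in case of ties); if this gap has length $x$ and starts at time $s_i$, set $s_j=s_i+p_j$; if $2p_j>x$, then every already placed job $k$ with $s_k>s_j$ is delayed by $2p_j-x$ (its starting time is increased by $2p_j-x$).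
   Formalization: The starting times $s_1,\dots,s_n$ of the feasible schedules against which Greedy's makespan is compared, and hence OPT, are taken over the rationals only. -}

module Defs where

open import Data.Nat as ℕ using (ℕ; zero; suc; _+_; _*_; _∸_; _⊔_; _<ᵇ_)
open import Data.Bool using (if_then_else_)
open import Data.Product using (_×_; _,_; proj₁; proj₂)
open import Data.List using (List; []; _∷_; map; foldl; length; lookup)
open import Data.Fin using (Fin)
open import Data.Integer using (+_)
import Data.Rational as ℚ
open ℚ using (ℚ; 0ℚ; _/_; ∣_∣; _-_)
open import Relation.Binary.PropositionalEquality using (_≢_)

data NonIncreasing : List ℕ → Set where
  ni-[]  : NonIncreasing []
  ni-[x] : ∀ {x} → NonIncreasing (x ∷ [])
  ni-∷   : ∀ {x y xs} → y ℕ.≤ x → NonIncreasing (y ∷ xs) → NonIncreasing (x ∷ y ∷ xs)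

data AllPositive : List ℕ → Set where
  pos-[] : AllPositive []
  pos-∷  : ∀ {x xs} → 0 ℕ.< x → AllPositive xs → AllPositive (x ∷ xs)

job : (p : List ℕ) → Fin (length p) → ℚ
job p j = (+ lookup p j) / 1

Feasible : (p : List ℕ) → (Fin (length p) → ℚ) → Set
Feasible p s =
  (∀ j → 0ℚ ℚ.≤ s j) ×
  (∀ i j → i ≢ j → (job p i ℚ.⊓ job p j) ℚ.≤ ∣ s i - s j ∣)

-- makespan  max_j (s_j + p_j)   (0 for the empty instance)
makespanAux : ∀ {n} → (Fin n → ℚ) → ℚ
makespanAux {zero}  f = 0ℚ
makespanAux {suc n} f = f Fin.zero ℚ.⊔ makespanAux {n} (λ j → f (Fin.suc j))


makespan : (p : List ℕ) → (Fin (length p) → ℚ) → ℚ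
makespan p s = makespanAux (λ j → s j ℚ.+ job p j)

-- The Greedy algorithm.  A partial schedule is the list of pairs
-- (starting time, processing time) of placed jobs, ordered by start time.

PSched : Set
PSched = List (ℕ × ℕ)

pmakespan : PSched → ℕ
pmakespan [] = 0
pmakespan ((s , q) ∷ rest) = (s + q) ⊔ pmakespan rest

gaps : ℕ → PSched → List ℕ
gaps C [] = []
gaps C ((s , q) ∷ []) = (C ∸ s) ∷ []
gaps C ((s , q) ∷ (s' , q') ∷ rest) = (s' ∸ s) ∷ gaps C ((s' , q') ∷ rest)

-- (index, length) of a largest gap, leftmost one in case of ties
bestGap : List ℕ → ℕ × ℕ
bestGap [] = (0 , 0)
bestGap (g ∷ gs) with bestGap gs
... | (i , v) = if g <ᵇ v then (suc i , v) else (0 , g)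

-- place job of length pj in the gap starting at the i-th start time
-- (a gap of length x): start at s_i + pj, delay later jobs by 2pj - x
insertJob : ℕ → ℕ → ℕ → PSched → PSched
insertJob pj x i [] = []
insertJob pj x zero ((s , q) ∷ rest) =
  (s , q) ∷ (s + pj , pj) ∷ map (λ e → (proj₁ e + (2 * pj ∸ x) , proj₂ e)) rest
insertJob pj x (suc i) (e ∷ rest) = e ∷ insertJob pj x i rest

greedyStep : PSched → ℕ → PSched
greedyStep [] pj = (0 , pj) ∷ []
greedyStep st@(_ ∷ _) pj with bestGap (gaps (pmakespan st) st)
... | (i , x) = insertJob pj x i st

greedySchedule : List ℕ → PSched
greedySchedule p = foldl greedyStep [] p

greedyMakespan : List ℕ → ℕ
greedyMakespan p = pmakespan (greedySchedule p)

-- After every step of Greedy its gaps can be matched bijectively with the jobs placed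
-- so far so that every gap is at most its job; and the gaps add up to the makespan.
-- Placing p into a largest gap x ≥ 2p delays nothing; if x < 2p, every gap is at most
-- x, so the new makespan is at most Σ_{i<ℓ} min(p_i, 2p_ℓ) + p_ℓ, where ℓ is the new
-- job.  Conversely, in any feasible schedule the jobs 1, …, ℓ truncated to length 2p_ℓ
-- have lengths a_i ∈ [p_ℓ, 2p_ℓ], so two of them that are consecutive in time start at
-- least min(a_i, a_j) ≥ (a_i + a_j)/3 apart; telescoping along the start times bounds
-- twice their total length by three times the makespan.
module Submission where

open import Data.Nat.Base as ℕ using (ℕ; _⊓_)
open import Data.List.Base using (List; map; _++_; _∷_)
open import Data.List.Relation.Unary.All using (All)
open import Data.Nat.ListAction using (sum)
open import Relation.Binary.PropositionalEquality using (_≡_)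

truncatedSum : ℕ → List ℕ → ℕ
truncatedSum c xs = sum (map (_⊓ c) xs)

record PrefixBound (C : ℕ) (ps : List ℕ) : Set where
  constructor prefixBound
  field
    front       : List ℕ
    pivot       : ℕ
    back        : List ℕ
    split       : ps ≡ front ++ pivot ∷ back
    pivot≤front : All (pivot ℕ.≤_) front
    bound       : C ℕ.≤ truncatedSum (2 ℕ.* pivot) front ℕ.+ pivot

module LowerBound where

  open import Data.Nat using (zero; suc; z≤n)
  import Data.Nat.Properties as ℕP
  open import Data.Nat.Tactic.RingSolver using (solve-∀)
  open import Data.Nat.Coprimality as Coprime using (1-coprimeTo)
  import Data.Integer as ℤ
  open ℤ using (+_)
  import Data.Integer.Properties as ℤP
  open import Data.Rational as ℚ using (ℚ; mkℚ; _/_; _≤_; _+_; _-_; _*_; 0ℚ; 1ℚ; ½; ∣_∣; *≤*; toℚᵘ)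
  open import Data.Rational.Properties
  import Data.Rational.Unnormalised as ℚᵘ
  import Data.Rational.Unnormalised.Properties as ℚᵘP
  open import Data.Rational.Solver using (module +-*-Solver)
  open +-*-Solver using (solve; _:+_; _:-_; _:*_; :-_; _:=_; con)
  open import Data.Product using (_×_; _,_; proj₁; proj₂)
  open import Data.Product.Relation.Binary.Lex.NonStrict using (×-decTotalOrder)
  open import Data.Sum using (inj₁; inj₂)
  open import Data.Fin as Fin using (Fin)
  open import Data.List using (_∷_; []; length; lookup; take; allFin; _++_)
  import Data.List.Properties as ListP
  open import Data.Nat.ListAction.Properties using (sum-↭; sum-++)
  open import Data.List.Relation.Unary.All as All using (All; []; _∷_)
  import Data.List.Relation.Unary.All.Properties as AllP
  open import Data.List.Relation.Unary.AllPairs as AllPairs using (AllPairs; []; _∷_)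
  import Data.List.Relation.Unary.AllPairs.Properties as AllPairsP
  open import Data.List.Relation.Unary.Linked as Linked using (Linked; []; _∷_)
  open import Data.List.Relation.Unary.Unique.Propositional.Properties using (allFin⁺; take⁺)
  open import Data.List.Relation.Binary.Permutation.Propositional using (_↭_; ↭-sym; ↭⇒↭ₛ)
  import Data.List.Relation.Binary.Permutation.Propositional.Properties as Perm
  import Data.List.Relation.Binary.Permutation.Setoid.Properties as Permₛ
  open import Relation.Binary.Bundles using (DecTotalOrder)
  open import Relation.Binary.PropositionalEquality
  open import Function using (_∘_; id)
  open import Defs using (Feasible; job; makespan; makespanAux)

  -- Kept abstract so that type checking never unfolds the gcd normalisation of + n / 1.
  abstract
    ι : ℕ → ℚ
    ι n = + n / 1

    ι≡/1 : ∀ n → ι n ≡ + n / 1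
    ι≡/1 n = refl

    ι0≡0 : ι 0 ≡ 0ℚ
    ι0≡0 = refl

    ι≡mkℚ : ∀ n → ι n ≡ mkℚ (+ n) 0 (Coprime.sym (1-coprimeTo n))
    ι≡mkℚ n = normalize-coprime (Coprime.sym (1-coprimeTo n))

  ι-mono-≤ : ∀ {m n} → m ℕ.≤ n → ι m ≤ ι n
  ι-mono-≤ {m} {n} m≤n rewrite ι≡mkℚ m | ι≡mkℚ n =
    *≤* (subst₂ ℤ._≤_ (sym (ℤP.*-identityʳ (+ m))) (sym (ℤP.*-identityʳ (+ n))) (ℤ.+≤+ m≤n))

  ι-homo-+ : ∀ m n → ι (m ℕ.+ n) ≡ ι m + ι n
  ι-homo-+ m n = toℚᵘ-injective (ℚᵘP.≃-trans toℚᵘ-sum (ℚᵘP.≃-sym (toℚᵘ-homo-+ (ι m) (ι n))))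
    where
    toℚᵘ-sum : toℚᵘ (ι (m ℕ.+ n)) ℚᵘ.≃ toℚᵘ (ι m) ℚᵘ.+ toℚᵘ (ι n)
    toℚᵘ-sum rewrite ι≡mkℚ m | ι≡mkℚ n | ι≡mkℚ (m ℕ.+ n) =
      ℚᵘ.*≡* (cong (ℤ._* + 1) (sym (cong₂ ℤ._+_ (ℤP.*-identityʳ (+ m)) (ℤP.*-identityʳ (+ n)))))

  ι-homo-* : ∀ m n → ι (m ℕ.* n) ≡ ι m * ι n
  ι-homo-* zero    n = trans ι0≡0 (sym (trans (cong (_* ι n) ι0≡0) (*-zeroˡ (ι n))))
  ι-homo-* (suc m) n = begin
    ι (n ℕ.+ m ℕ.* n)   ≡⟨ ι-homo-+ n (m ℕ.* n) ⟩
    ι n + ι (m ℕ.* n)   ≡⟨ cong (λ v → ι n + v) (ι-homo-* m n) ⟩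
    ι n + ι m * ι n     ≡⟨ solve 2 (λ x y → y :+ x :* y := (con 1ℚ :+ x) :* y) refl (ι m) (ι n) ⟩
    (1ℚ + ι m) * ι n    ≡⟨ cong (λ v → (v + ι m) * ι n) (sym (ι≡/1 1)) ⟩
    (ι 1 + ι m) * ι n   ≡⟨ cong (_* ι n) (sym (ι-homo-+ 1 m)) ⟩
    ι (suc m) * ι n     ∎
    where open ≡-Reasoning

  instance
    ι-nonNegative : ∀ {n} → ℚ.NonNegative (ι n)
    ι-nonNegative {n} = ℚ.nonNegative (subst (_≤ ι n) ι0≡0 (ι-mono-≤ {0} {n} z≤n))

  3ℚ : ℚ
  3ℚ = ι 3

  0≤3ℚ* : ∀ {x} → 0ℚ ≤ x → 0ℚ ≤ 3ℚ * x
  0≤3ℚ* 0≤x = ≤-trans (≤-reflexive (sym (*-zeroʳ 3ℚ))) (*-monoˡ-≤-nonNeg 3ℚ 0≤x)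

  +-cancelʳ-≤ : ∀ r {p q} → p + r ≤ q + r → p ≤ q
  +-cancelʳ-≤ r {p} {q} p+r≤q+r = begin
    p          ≡⟨ solve 2 (λ p r → p := p :+ r :- r) refl p r ⟩
    p + r - r  ≤⟨ +-monoˡ-≤ (ℚ.- r) p+r≤q+r ⟩
    q + r - r  ≡⟨ solve 2 (λ q r → q :+ r :- r := q) refl q r ⟩
    q          ∎
    where open ≤-Reasoning

  ∣p-q∣≡∣q-p∣ : ∀ p q → ∣ p - q ∣ ≡ ∣ q - p ∣
  ∣p-q∣≡∣q-p∣ p q = trans (cong ∣_∣ (solve 2 (λ u v → u :- v := :- (v :- u)) refl p q)) (∣-p∣≡∣p∣ (q - p))

  Placement : Set
  Placement = ℚ × ℕ

  startTime : Placement → ℚ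
  startTime = proj₁

  duration : Placement → ℕ
  duration = proj₂

  endTime : Placement → ℚ
  endTime x = startTime x + ι (duration x)

  Separated : Placement → Placement → Set
  Separated x y = ι (duration x ⊓ duration y) ≤ ∣ startTime x - startTime y ∣

  Within : ℕ → ℕ → Set
  Within q a = q ℕ.≤ a × a ℕ.≤ 2 ℕ.* q

  Ascending : List Placement → Set
  Ascending = Linked (λ x y → startTime x ≤ startTime y)

  totalDuration : List Placement → ℕ
  totalDuration xs = sum (map duration xs)

  Separated-sym : ∀ {x y} → Separated x y → Separated y x
  Separated-sym {x} {y} =
    subst₂ (λ m d → ι m ≤ d) (ℕP.⊓-comm (duration x) (duration y)) (∣p-q∣≡∣q-p∣ (startTime x) (startTime y))

  +≤3*⊓ : ∀ {q a b} → Within q a → Within q b → a ℕ.+ b ℕ.≤ 3 ℕ.* (a ⊓ b)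
  +≤3*⊓ {q} {a} {b} (q≤a , a≤2q) (q≤b , b≤2q) with ℕP.≤-total a b
  ... | inj₁ a≤b rewrite ℕP.m≤n⇒m⊓n≡m a≤b =
    ℕP.+-monoʳ-≤ a (ℕP.≤-trans b≤2q (ℕP.*-monoʳ-≤ 2 q≤a))
  ... | inj₂ b≤a rewrite ℕP.m≥n⇒m⊓n≡n b≤a | ℕP.+-comm a b =
    ℕP.+-monoʳ-≤ b (ℕP.≤-trans a≤2q (ℕP.*-monoʳ-≤ 2 q≤b))

  separated-ascending : ∀ {x y} → startTime x ≤ startTime y → Separated x y →
    startTime x + ι (duration x ⊓ duration y) ≤ startTime y
  separated-ascending {x} {y} sx≤sy sep = begin
    sx + ι (duration x ⊓ duration y)  ≤⟨ +-monoʳ-≤ sx (≤-trans sep (≤-reflexive ∣sx-sy∣≡sy-sx)) ⟩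
    sx + (sy - sx)                    ≡⟨ solve 2 (λ u v → u :+ (v :- u) := v) refl sx sy ⟩
    sy                                ∎
    where
    open ≤-Reasoning
    sx = startTime x
    sy = startTime y
    0≤sy-sx : 0ℚ ≤ sy - sx
    0≤sy-sx = ≤-trans (≤-reflexive (sym (+-inverseʳ sx))) (+-monoˡ-≤ (ℚ.- sx) sx≤sy)
    ∣sx-sy∣≡sy-sx : ∣ sx - sy ∣ ≡ sy - sx
    ∣sx-sy∣≡sy-sx = trans (∣p-q∣≡∣q-p∣ sx sy) (0≤p⇒∣p∣≡p 0≤sy-sx)

  separated-spacing : ∀ {q x y} → Within q (duration x) → Within q (duration y) →
    startTime x ≤ startTime y → Separated x y →
    3ℚ * startTime x + ι (duration x ℕ.+ duration y) ≤ 3ℚ * startTime y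
  separated-spacing {q} {x} {y} wx wy sx≤sy sep = begin
    3ℚ * sx + ι (duration x ℕ.+ duration y)  ≤⟨ +-monoʳ-≤ (3ℚ * sx) (ι-mono-≤ (+≤3*⊓ wx wy)) ⟩
    3ℚ * sx + ι (3 ℕ.* m)                   ≡⟨ cong (λ v → 3ℚ * sx + v) (ι-homo-* 3 m) ⟩
    3ℚ * sx + 3ℚ * ι m                      ≡⟨ sym (*-distribˡ-+ 3ℚ sx (ι m)) ⟩
    3ℚ * (sx + ι m)                         ≤⟨ *-monoˡ-≤-nonNeg 3ℚ (separated-ascending {x} {y} sx≤sy sep) ⟩
    3ℚ * startTime y                        ∎
    where
    open ≤-Reasoning
    sx = startTime x
    m = duration x ⊓ duration y

  private
    double-regroup : ∀ a Σ q → 2 ℕ.* (a ℕ.+ Σ) ℕ.+ 2 ℕ.* q ≡ 2 ℕ.* Σ ℕ.+ 2 ℕ.* q ℕ.+ a ℕ.+ a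
    double-regroup = solve-∀

    double≡triple+1 : ∀ a → 2 ℕ.* (a ℕ.+ 0) ℕ.+ 2 ℕ.* a ≡ 3 ℕ.* a ℕ.+ a
    double≡triple+1 = solve-∀

  -- Telescoping from x along the chain; the 2q is paid for by the last placement,
  -- whose duration is at least q.
  ascending-bound : ∀ {q M x} xs → Ascending (x ∷ xs) → AllPairs Separated (x ∷ xs) →
    All (Within q ∘ duration) (x ∷ xs) → All (λ y → endTime y ≤ M) (x ∷ xs) →
    ι (2 ℕ.* totalDuration (x ∷ xs) ℕ.+ 2 ℕ.* q) + 3ℚ * startTime x ≤ 3ℚ * M + ι (duration x)
  ascending-bound {q} {M} {x} [] _ _ ((q≤a , _) ∷ []) (x≤M ∷ []) = begin
    ι (2 ℕ.* (a ℕ.+ 0) ℕ.+ 2 ℕ.* q) + 3ℚ * s  ≤⟨ +-monoˡ-≤ (3ℚ * s) (ι-mono-≤ 2a+2q≤3a+a) ⟩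
    ι (3 ℕ.* a ℕ.+ a) + 3ℚ * s               ≡⟨ cong (_+ 3ℚ * s) (trans (ι-homo-+ (3 ℕ.* a) a)
                                                                         (cong (_+ ι a) (ι-homo-* 3 a))) ⟩
    3ℚ * ι a + ι a + 3ℚ * s                 ≡⟨ solve 3 (λ t u v → t :* u :+ u :+ t :* v := t :* (v :+ u) :+ u)
                                                        refl 3ℚ (ι a) s ⟩
    3ℚ * endTime x + ι a                    ≤⟨ +-monoˡ-≤ (ι a) (*-monoˡ-≤-nonNeg 3ℚ x≤M) ⟩
    3ℚ * M + ι a                            ∎
    where
    open ≤-Reasoning
    a = duration x
    s = startTime x
    2a+2q≤3a+a : 2 ℕ.* (a ℕ.+ 0) ℕ.+ 2 ℕ.* q ℕ.≤ 3 ℕ.* a ℕ.+ a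
    2a+2q≤3a+a = ℕP.≤-trans (ℕP.+-monoʳ-≤ (2 ℕ.* (a ℕ.+ 0)) (ℕP.*-monoʳ-≤ 2 q≤a))
                            (ℕP.≤-reflexive (double≡triple+1 a))
  ascending-bound {q} {M} {x} (y ∷ ys) (sx≤sy ∷ asc) ((sep ∷ _) ∷ seps) (wx ∷ ws@(wy ∷ _)) (_ ∷ ends) =
    +-cancelʳ-≤ (T' + ι b) (begin
      ι (2 ℕ.* (a ℕ.+ Σ) ℕ.+ 2 ℕ.* q) + T + (T' + ι b)  ≡⟨ rearrange ⟩
      (ι X + T') + (T + ι (a ℕ.+ b)) + ι a              ≤⟨ +-monoˡ-≤ (ι a)
                                                              (+-mono-≤ (ascending-bound ys asc seps ws ends)
                                                                        (separated-spacing {q} {x} {y} wx wy sx≤sy sep)) ⟩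
      (3ℚ * M + ι b) + T' + ι a                          ≡⟨ solve 4 (λ m b t a → m :+ b :+ t :+ a := m :+ a :+ (t :+ b))
                                                                    refl (3ℚ * M) (ι b) T' (ι a) ⟩
      3ℚ * M + ι a + (T' + ι b)                          ∎)
    where
    open ≤-Reasoning
    a = duration x
    b = duration y
    Σ = totalDuration (y ∷ ys)
    X = 2 ℕ.* Σ ℕ.+ 2 ℕ.* q
    T = 3ℚ * startTime x
    T' = 3ℚ * startTime y
    rearrange : ι (2 ℕ.* (a ℕ.+ Σ) ℕ.+ 2 ℕ.* q) + T + (T' + ι b) ≡ (ι X + T') + (T + ι (a ℕ.+ b)) + ι a
    rearrange = begin-equality
      ι (2 ℕ.* (a ℕ.+ Σ) ℕ.+ 2 ℕ.* q) + T + (T' + ι b)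
        ≡⟨ cong (λ u → u + T + (T' + ι b))
                (trans (cong ι (double-regroup a Σ q))
                       (trans (ι-homo-+ (X ℕ.+ a) a) (cong (_+ ι a) (ι-homo-+ X a)))) ⟩
      (ι X + ι a + ι a) + T + (T' + ι b)
        ≡⟨ solve 5 (λ X A B t t' → (X :+ A :+ A) :+ t :+ (t' :+ B) := (X :+ t') :+ (t :+ (A :+ B)) :+ A)
                 refl (ι X) (ι a) (ι b) T T' ⟩
      (ι X + T') + (T + (ι a + ι b)) + ι a
        ≡⟨ cong (λ v → (ι X + T') + (T + v) + ι a) (sym (ι-homo-+ a b)) ⟩
      (ι X + T') + (T + ι (a ℕ.+ b)) + ι a  ∎

  ascending-totalDuration : ∀ {q M x} xs → Ascending (x ∷ xs) → AllPairs Separated (x ∷ xs) →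
    All (Within q ∘ duration) (x ∷ xs) → All (λ y → endTime y ≤ M) (x ∷ xs) → 0ℚ ≤ startTime x →
    ι (2 ℕ.* totalDuration (x ∷ xs)) ≤ 3ℚ * M
  ascending-totalDuration {q} {M} {x} xs asc seps ws@((_ , a≤2q) ∷ _) ends 0≤s =
    +-cancelʳ-≤ (ι (2 ℕ.* q)) (begin
      ι (2 ℕ.* Σ) + ι (2 ℕ.* q)    ≡⟨ sym (ι-homo-+ (2 ℕ.* Σ) (2 ℕ.* q)) ⟩
      ι X                          ≡⟨ +-identityʳ (ι X) ⟨
      ι X + 0ℚ                     ≤⟨ +-monoʳ-≤ (ι X) (0≤3ℚ* 0≤s) ⟩
      ι X + 3ℚ * startTime x       ≤⟨ ascending-bound xs asc seps ws ends ⟩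
      3ℚ * M + ι (duration x)      ≤⟨ +-monoʳ-≤ (3ℚ * M) (ι-mono-≤ a≤2q) ⟩
      3ℚ * M + ι (2 ℕ.* q)         ∎)
    where
    open ≤-Reasoning
    Σ = totalDuration (x ∷ xs)
    X = 2 ℕ.* Σ ℕ.+ 2 ℕ.* q

  -- Data.List.Sort needs a total order; the duration component only breaks ties.
  startTimeOrder : DecTotalOrder _ _ _
  startTimeOrder = ×-decTotalOrder ≤-decTotalOrder ℕP.≤-decTotalOrder

  open import Data.List.Sort startTimeOrder using (sort; sort-↭; sort-↗)

  separated-totalDuration : ∀ {q M} xs → 0ℚ ≤ M → AllPairs Separated xs →
    All (Within q ∘ duration) xs → All (λ y → 0ℚ ≤ startTime y) xs → All (λ y → endTime y ≤ M) xs →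
    ι (2 ℕ.* totalDuration xs) ≤ 3ℚ * M
  separated-totalDuration {q} {M} xs 0≤M seps ws 0≤starts ends =
    subst (λ Σ → ι (2 ℕ.* Σ) ≤ 3ℚ * M) (sum-↭ (Perm.map⁺ duration (sort-↭ xs)))
      (sorted-bound (sort xs) (sort-↗ xs) (↭-sym (sort-↭ xs)))
    where
    lex⇒≤ : ∀ {u v} → DecTotalOrder._≤_ startTimeOrder u v → startTime u ≤ startTime v
    lex⇒≤ (inj₁ (su≤sv , _)) = su≤sv
    lex⇒≤ (inj₂ (su≡sv , _)) = ≤-reflexive su≡sv
    sorted-bound : ∀ ys → Linked (DecTotalOrder._≤_ startTimeOrder) ys → xs ↭ ys →
      ι (2 ℕ.* totalDuration ys) ≤ 3ℚ * M
    sorted-bound [] _ _ = subst (_≤ 3ℚ * M) (sym ι0≡0) (0≤3ℚ* 0≤M)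
    sorted-bound (y ∷ ys) sorted xs↭ = ascending-totalDuration ys (Linked.map lex⇒≤ sorted)
      (Permₛ.AllPairs-resp-↭ (setoid Placement) (λ {u} {v} → Separated-sym {u} {v}) (resp₂ Separated)
                             (↭⇒↭ₛ xs↭) seps)
      (Perm.All-resp-↭ xs↭ ws) (Perm.All-resp-↭ xs↭ ends) (All.head (Perm.All-resp-↭ xs↭ 0≤starts))

  makespanAux-≥ : ∀ {n} (f : Fin n → ℚ) j → f j ≤ makespanAux f
  makespanAux-≥ f Fin.zero    = p≤p⊔q (f Fin.zero) _
  makespanAux-≥ f (Fin.suc j) = ≤-trans (makespanAux-≥ (f ∘ Fin.suc) j) (p≤q⊔p (f Fin.zero) _)

  0≤makespanAux : ∀ {n} (f : Fin n → ℚ) → 0ℚ ≤ makespanAux f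
  0≤makespanAux {zero}  f = ≤-refl
  0≤makespanAux {suc n} f = ≤-trans (0≤makespanAux (f ∘ Fin.suc)) (p≤q⊔p (f Fin.zero) _)

  take-++-∷ : ∀ (ys : List ℕ) q zs → take (suc (length ys)) (ys ++ q ∷ zs) ≡ ys ++ q ∷ []
  take-++-∷ []       q zs = refl
  take-++-∷ (y ∷ ys) q zs = cong (y ∷_) (take-++-∷ ys q zs)

  makespan-lowerBound : ∀ {C} (p : List ℕ) s → Feasible p s → PrefixBound C p →
    ι (2 ℕ.* C) ≤ 3ℚ * makespan p s
  makespan-lowerBound p s (0≤s , feasible) (prefixBound ys q zs p≡ys++q∷zs q≤ys C≤) =
    ≤-trans (ι-mono-≤ (ℕP.*-monoʳ-≤ 2 C≤)) (subst (λ Σ → ι (2 ℕ.* Σ) ≤ 3ℚ * makespan p s) totalDuration≡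
      (separated-totalDuration (map placement prefix) (0≤makespanAux (λ j → s j + job p j))
        (AllPairsP.map⁺ (AllPairs.map separation (take⁺ (suc (length ys)) (allFin⁺ (length p)))))
        (AllP.map⁺ (All.map within (AllP.map⁻ (subst (All (q ℕ.≤_)) (sym lookup-prefix)
                                                      (AllP.++⁺ q≤ys (ℕP.≤-refl ∷ []))))))
        (AllP.map⁺ (All.tabulate (λ {j} _ → 0≤s j)))
        (AllP.map⁺ (All.tabulate (λ {j} _ → ends j)))))
    where
    prefix = take (suc (length ys)) (allFin (length p))
    placement : Fin (length p) → Placement
    placement j = s j , lookup p j ⊓ (2 ℕ.* q)
    lookup-prefix : map (lookup p) prefix ≡ ys ++ q ∷ []
    lookup-prefix = begin
      map (lookup p) prefix                ≡⟨ sym (ListP.take-map (suc (length ys)) (allFin (length p))) ⟩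
      take _ (map (lookup p) (allFin _))   ≡⟨ cong (take (suc (length ys))) (trans (ListP.map-tabulate id (lookup p))
                                                                                   (ListP.tabulate-lookup p)) ⟩
      take _ p                             ≡⟨ cong (take (suc (length ys))) p≡ys++q∷zs ⟩
      take _ (ys ++ q ∷ zs)                ≡⟨ take-++-∷ ys q zs ⟩
      ys ++ q ∷ []                         ∎
      where open ≡-Reasoning
    totalDuration≡ : totalDuration (map placement prefix) ≡ truncatedSum (2 ℕ.* q) ys ℕ.+ q
    totalDuration≡ = begin
      sum (map duration (map placement prefix))          ≡⟨ cong sum (ListP.map-∘ prefix) ⟨
      sum (map ((_⊓ (2 ℕ.* q)) ∘ lookup p) prefix)       ≡⟨ cong sum (ListP.map-∘ prefix) ⟩
      sum (map (_⊓ (2 ℕ.* q)) (map (lookup p) prefix))   ≡⟨ cong (sum ∘ map (_⊓ (2 ℕ.* q))) lookup-prefix ⟩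
      sum (map (_⊓ (2 ℕ.* q)) (ys ++ q ∷ []))            ≡⟨ cong sum (ListP.map-++ (_⊓ (2 ℕ.* q)) ys (q ∷ [])) ⟩
      sum (map (_⊓ (2 ℕ.* q)) ys ++ q ⊓ (2 ℕ.* q) ∷ [])  ≡⟨ sum-++ (map (_⊓ (2 ℕ.* q)) ys) _ ⟩
      truncatedSum (2 ℕ.* q) ys ℕ.+ (q ⊓ (2 ℕ.* q) ℕ.+ 0) ≡⟨ cong (truncatedSum (2 ℕ.* q) ys ℕ.+_)
                                                             (trans (ℕP.+-identityʳ _) (ℕP.m≤n⇒m⊓n≡m (ℕP.m≤n*m q 2))) ⟩
      truncatedSum (2 ℕ.* q) ys ℕ.+ q                    ∎
      where open ≡-Reasoning
    duration≤job : ∀ j → ι (duration (placement j)) ≤ job p j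
    duration≤job j = ≤-trans (ι-mono-≤ (ℕP.m⊓n≤m (lookup p j) (2 ℕ.* q))) (≤-reflexive (ι≡/1 (lookup p j)))
    separation : ∀ {i j} → i ≢ j → Separated (placement i) (placement j)
    separation {i} {j} i≢j = ≤-trans
      (⊓-glb (≤-trans (ι-mono-≤ (ℕP.m⊓n≤m (duration (placement i)) (duration (placement j)))) (duration≤job i))
             (≤-trans (ι-mono-≤ (ℕP.m⊓n≤n (duration (placement i)) (duration (placement j)))) (duration≤job j)))
      (feasible i j i≢j)
    within : ∀ {j} → q ℕ.≤ lookup p j → Within q (duration (placement j))
    within q≤pj = ℕP.⊓-glb q≤pj (ℕP.m≤n*m q 2) , ℕP.m⊓n≤n _ _
    ends : ∀ j → endTime (placement j) ≤ makespan p s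
    ends j = ≤-trans (+-monoʳ-≤ (s j) (duration≤job j)) (makespanAux-≥ (λ k → s k + job p k) j)

  ≤-three-halves : ∀ C M → ι (2 ℕ.* C) ≤ 3ℚ * M → (+ C) / 1 ≤ ((+ 3) / 2) * M
  ≤-three-halves C M 2C≤3M = begin
    (+ C) / 1                 ≡⟨ sym (ι≡/1 C) ⟩
    ι C                       ≡⟨ solve 1 (λ c → c := con ½ :* (con ((+ 2) / 1) :* c)) refl (ι C) ⟩
    ½ * ((+ 2) / 1 * ι C)     ≡⟨ cong (λ v → ½ * (v * ι C)) (sym (ι≡/1 2)) ⟩
    ½ * (ι 2 * ι C)           ≡⟨ cong (½ *_) (sym (ι-homo-* 2 C)) ⟩
    ½ * ι (2 ℕ.* C)           ≤⟨ *-monoˡ-≤-nonNeg ½ 2C≤3M ⟩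
    ½ * (3ℚ * M)              ≡⟨ cong (λ v → ½ * (v * M)) (ι≡/1 3) ⟩
    ½ * ((+ 3) / 1 * M)       ≡⟨ solve 1 (λ m → con ½ :* (con ((+ 3) / 1) :* m) := con ((+ 3) / 2) :* m)
                                         refl M ⟩
    ((+ 3) / 2) * M           ∎
    where open ≤-Reasoning

module UpperBound where

  open import Data.Nat using (zero; suc; _+_; _*_; _∸_; _≤_; _<ᵇ_; z≤n)
  open import Data.Nat.Properties
  open import Algebra.Properties.CommutativeSemigroup +-commutativeSemigroup using (xy∙z≈xz∙y)
  open import Data.Nat.ListAction.Properties using (sum-↭)
  open import Data.Bool using (true; false; T)
  open import Data.List using ([]; _∷_; foldl; _++_)
  open import Data.List.Properties using (++-assoc; ++-identityʳ)
  open import Data.List.Relation.Unary.All as All using (All; []; _∷_)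
  open import Data.List.Relation.Unary.All.Properties using (++⁺)
  open import Data.List.Relation.Unary.Linked using (Linked; []; [-]; _∷_)
  open import Data.List.Relation.Binary.Pointwise as Pointwise using (Pointwise; []; _∷_)
  open import Data.List.Relation.Binary.Permutation.Propositional
    using (_↭_; ↭-refl; ↭-prep; ↭-swap; ↭-trans; ↭-sym)
  open import Data.List.Relation.Binary.Permutation.Propositional.Properties
    using (All-resp-↭; ∷↭∷ʳ; map⁺)
  open import Data.Product using (∃; _×_; _,_; proj₁; proj₂)
  open import Data.Sum using (inj₁; inj₂)
  open import Relation.Binary.PropositionalEquality
  open import Defs
    using (PSched; pmakespan; gaps; bestGap; insertJob; greedyStep; greedyMakespan; NonIncreasing; ni-∷)

  StartsAscending : PSched → Set
  StartsAscending = Linked (λ e e' → proj₁ e ≤ proj₁ e')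

  infix 4 _[_]=_
  data _[_]=_ : List ℕ → ℕ → ℕ → Set where
    here  : ∀ {x xs} → (x ∷ xs) [ 0 ]= x
    there : ∀ {y xs i x} → xs [ i ]= x → (y ∷ xs) [ suc i ]= x

  replace₂ : ℕ → ℕ → ℕ → List ℕ → List ℕ
  replace₂ _       _ _ []       = []
  replace₂ zero    a b (_ ∷ xs) = a ∷ b ∷ xs
  replace₂ (suc i) a b (y ∷ xs) = y ∷ replace₂ i a b xs

  module _ {R : ℕ → ℕ → Set} where

    pointwise-lookup : ∀ {xs ys i v} → Pointwise R xs ys → xs [ i ]= v → ∃ λ b → ys [ i ]= b × R v b
    pointwise-lookup (r ∷ _)   here       = _ , here , r
    pointwise-lookup (_ ∷ rs) (there at) with pointwise-lookup rs at
    ... | b , at' , r = b , there at' , r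

    replace₂-pointwise : ∀ {xs ys i v a a' c c'} → Pointwise R xs ys → xs [ i ]= v → R a a' → R c c' →
      Pointwise R (replace₂ i a c xs) (replace₂ i a' c' ys)
    replace₂-pointwise (_ ∷ rs) here       ra rc = ra ∷ rc ∷ rs
    replace₂-pointwise (r ∷ rs) (there at) ra rc = r ∷ replace₂-pointwise rs at ra rc

  replace₂-↭ : ∀ {xs i b} a → xs [ i ]= b → replace₂ i a b xs ↭ a ∷ xs
  replace₂-↭ a here = ↭-refl
  replace₂-↭ {y ∷ xs} a (there at) = ↭-trans (↭-prep y (replace₂-↭ a at)) (↭-swap y a ↭-refl)

  []=-All : ∀ {P : ℕ → Set} {xs i b} → All P xs → xs [ i ]= b → P b
  []=-All (pb ∷ _) here       = pb
  []=-All (_ ∷ ps) (there at) = []=-All ps at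

  bestGap-spec : ∀ g gs → let (i , x) = bestGap (g ∷ gs) in (g ∷ gs) [ i ]= x × All (_≤ x) (g ∷ gs)
  bestGap-spec g [] = here , (≤-refl ∷ [])
  bestGap-spec g (h ∷ hs) with bestGap (h ∷ hs) | bestGap-spec h hs
  ... | (i , v) | (at , max) with g <ᵇ v in eq
  ... | true  = there at , (<⇒≤ (<ᵇ⇒< g v (subst T (sym eq) _)) ∷ max)
  ... | false = here , (≤-refl ∷ All.map (λ h≤v → ≤-trans h≤v v≤g) max)
    where
    v≤g : v ≤ g
    v≤g = ≮⇒≥ (λ g<v → subst T eq (<⇒<ᵇ g<v))

  EndsBy : ℕ → PSched → Set
  EndsBy C = All (λ e → proj₁ e + proj₂ e ≤ C)

  endsBy-pmakespan : ∀ st → EndsBy (pmakespan st) st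
  endsBy-pmakespan [] = []
  endsBy-pmakespan ((s , q) ∷ st) =
    m≤m⊔n (s + q) _ ∷ All.map (λ e≤ → ≤-trans e≤ (m≤n⊔m (s + q) _)) (endsBy-pmakespan st)

  pmakespan-least : ∀ {C st} → EndsBy C st → pmakespan st ≤ C
  pmakespan-least [] = z≤n
  pmakespan-least (e≤ ∷ st≤) = ⊔-lub e≤ (pmakespan-least st≤)

  -- Job p splits a gap of length x into gaps p and rest; every later job moves by delay.
  module Insertion (p x : ℕ) where

    delay : ℕ
    delay = 2 * p ∸ x

    rest : ℕ
    rest = (x + delay) ∸ p

    shift : ℕ × ℕ → ℕ × ℕ
    shift (s , q) = (s + delay , q)

    shifted-diff : ∀ a b → (a + delay) ∸ (b + delay) ≡ a ∸ b
    shifted-diff a b = trans (cong₂ _∸_ (+-comm a delay) (+-comm b delay)) ([m+n]∸[m+o]≡n∸o delay a b)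

    2p≤x+delay : 2 * p ≤ x + delay
    2p≤x+delay = m≤n+m∸n (2 * p) x

    insertJob-∷ : ∀ i e es → ∃ λ ys → insertJob p x i (e ∷ es) ≡ e ∷ ys
    insertJob-∷ zero    e es = _ , refl
    insertJob-∷ (suc i) e es = _ , refl

    shift-ascending : ∀ {st} → StartsAscending st → StartsAscending (map shift st)
    shift-ascending []          = []
    shift-ascending [-]         = [-]
    shift-ascending (s≤s' ∷ st) = +-monoˡ-≤ delay s≤s' ∷ shift-ascending st

    shift-endsBy : ∀ {C st} → EndsBy C st → EndsBy (C + delay) (map shift st)
    shift-endsBy [] = []
    shift-endsBy {C} {(s , q) ∷ _} (e≤ ∷ st≤) =
      ≤-trans (≤-reflexive (xy∙z≈xz∙y s delay q)) (+-monoˡ-≤ delay e≤) ∷ shift-endsBy st≤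

    placed-end : ∀ s → s + p + p ≤ s + x + delay
    placed-end s = begin
      s + p + p       ≡⟨ +-assoc s p p ⟩
      s + (p + p)     ≡⟨ cong (s +_) (cong (p +_) (sym (+-identityʳ p))) ⟩
      s + 2 * p       ≤⟨ +-monoʳ-≤ s 2p≤x+delay ⟩
      s + (x + delay) ≡⟨ sym (+-assoc s x delay) ⟩
      s + x + delay   ∎
      where open ≤-Reasoning

    gap-end : ∀ {s s'} → s ≤ s' → x ≡ s' ∸ s → s + x ≡ s'
    gap-end s≤s' refl = m+[n∸m]≡n s≤s'

    placed≤shifted : ∀ {s s'} → s ≤ s' → x ≡ s' ∸ s → s + p ≤ s' + delay
    placed≤shifted {s} {s'} s≤s' x≡ =
      ≤-trans (m≤m+n (s + p) p) (≤-trans (placed-end s) (≤-reflexive (cong (_+ delay) (gap-end s≤s' x≡))))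

    insert-ascending : ∀ i st C → StartsAscending st → gaps C st [ i ]= x → StartsAscending (insertJob p x i st)
    insert-ascending zero ((s , q) ∷ []) C _ _ = m≤m+n s p ∷ [-]
    insert-ascending zero ((s , q) ∷ (s' , q') ∷ st) C (s≤s' ∷ asc) here =
      m≤m+n s p ∷ placed≤shifted s≤s' refl ∷ shift-ascending asc
    insert-ascending (suc i) (_ ∷ []) C _ (there ())
    insert-ascending (suc i) ((s , q) ∷ (s' , q') ∷ st) C (s≤s' ∷ asc) (there at)
      with insertJob-∷ i (s' , q') st | insert-ascending i ((s' , q') ∷ st) C asc at
    ... | ys , eq | asc' rewrite eq = s≤s' ∷ asc'

    insert-endsBy : ∀ i st C → EndsBy C st → StartsAscending st → gaps C st [ i ]= x →
      EndsBy (C + delay) (insertJob p x i st)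
    insert-endsBy zero ((s , q) ∷ []) C (e≤ ∷ []) _ here =
      ≤-trans e≤ (m≤m+n C delay)
      ∷ ≤-trans (placed-end s) (≤-reflexive (cong (_+ delay) (gap-end (≤-trans (m≤m+n s q) e≤) refl)))
      ∷ []
    insert-endsBy zero ((s , q) ∷ (s' , q') ∷ st) C (e≤ ∷ st≤@(e'≤ ∷ _)) (s≤s' ∷ _) here =
      ≤-trans e≤ (m≤m+n C delay)
      ∷ ≤-trans (placed-end s) (≤-trans (≤-reflexive (cong (_+ delay) (gap-end s≤s' refl)))
                                          (+-monoˡ-≤ delay (≤-trans (m≤m+n s' q') e'≤)))
      ∷ shift-endsBy st≤
    insert-endsBy (suc i) (_ ∷ []) C _ _ (there ())
    insert-endsBy (suc i) ((s , q) ∷ (s' , q') ∷ st) C (e≤ ∷ st≤) (_ ∷ asc) (there at)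
      with insertJob-∷ i (s' , q') st | insert-endsBy i ((s' , q') ∷ st) C st≤ asc at
    ... | ys , eq | st≤' rewrite eq = ≤-trans e≤ (m≤m+n C delay) ∷ st≤'

    right-gap : ∀ {s A A'} → s ≤ A → x ≡ A ∸ s → A' ≤ A + delay → A' ∸ (s + p) ≤ rest
    right-gap {s} {A} {A'} s≤A refl A'≤ = begin
      A' ∸ (s + p)             ≡⟨ sym (∸-+-assoc A' s p) ⟩
      A' ∸ s ∸ p               ≤⟨ ∸-monoˡ-≤ p (∸-monoˡ-≤ s A'≤) ⟩
      A + delay ∸ s ∸ p        ≡⟨ cong (_∸ p) (+-∸-comm delay s≤A) ⟩
      A ∸ s + delay ∸ p        ∎
      where open ≤-Reasoning

    shift-gaps : ∀ s q st C C' → C' ≤ C + delay →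
      Pointwise _≤_ (gaps C' (map shift ((s , q) ∷ st))) (gaps C ((s , q) ∷ st))
    shift-gaps s q []               C C' C'≤ =
      ≤-trans (∸-monoˡ-≤ (s + delay) C'≤) (≤-reflexive (shifted-diff C s)) ∷ []
    shift-gaps s q ((s' , q') ∷ st) C C' C'≤ = ≤-reflexive (shifted-diff s' s) ∷ shift-gaps s' q' st C C' C'≤

    insert-gaps : ∀ i st C C' → EndsBy C st → StartsAscending st → gaps C st [ i ]= x → C' ≤ C + delay →
      Pointwise _≤_ (gaps C' (insertJob p x i st)) (replace₂ i p rest (gaps C st))
    insert-gaps zero ((s , q) ∷ []) C C' (e≤ ∷ []) _ here C'≤ =
      ≤-reflexive (m+n∸m≡n s p) ∷ right-gap (≤-trans (m≤m+n s q) e≤) refl C'≤ ∷ []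
    insert-gaps zero ((s , q) ∷ (s' , q') ∷ st) C C' _ (s≤s' ∷ _) here C'≤ =
      ≤-reflexive (m+n∸m≡n s p) ∷ right-gap s≤s' refl ≤-refl ∷ shift-gaps s' q' st C C' C'≤
    insert-gaps (suc i) (_ ∷ []) C C' _ _ (there ()) _
    insert-gaps (suc i) ((s , q) ∷ (s' , q') ∷ st) C C' (_ ∷ st≤) (_ ∷ asc) (there at) C'≤
      with insertJob-∷ i (s' , q') st | insert-gaps i ((s' , q') ∷ st) C C' st≤ asc at C'≤
    ... | ys , eq | gaps≤ rewrite eq = ≤-refl ∷ gaps≤

    rest≤ : ∀ {b} → x ≤ b → p ≤ b → rest ≤ b
    rest≤ {b} x≤b p≤b with ≤-total (2 * p) x
    ... | inj₁ 2p≤x rewrite m≤n⇒m∸n≡0 2p≤x | +-identityʳ x = ≤-trans (m∸n≤m x p) x≤b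
    ... | inj₂ x≤2p rewrite m+[n∸m]≡n x≤2p =
      ≤-trans (≤-reflexive (trans (m+n∸m≡n p (p + 0)) (+-identityʳ p))) p≤b

  sum-gaps : ∀ s q st C → StartsAscending ((s , q) ∷ st) → EndsBy C ((s , q) ∷ st) →
    sum (gaps C ((s , q) ∷ st)) + s ≡ C
  sum-gaps s q [] C _ (e≤ ∷ []) =
    trans (cong (_+ s) (+-identityʳ (C ∸ s))) (m∸n+n≡m (≤-trans (m≤m+n s q) e≤))
  sum-gaps s q ((s' , q') ∷ st) C (s≤s' ∷ asc) (_ ∷ st≤) = begin
    s' ∸ s + G + s   ≡⟨ cong (_+ s) (+-comm (s' ∸ s) G) ⟩
    G + (s' ∸ s) + s ≡⟨ +-assoc G (s' ∸ s) s ⟩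
    G + (s' ∸ s + s) ≡⟨ cong (G +_) (m∸n+n≡m s≤s') ⟩
    G + s'           ≡⟨ sum-gaps s' q' st C asc st≤ ⟩
    C                ∎
    where
    open ≡-Reasoning
    G = sum (gaps C ((s' , q') ∷ st))

  sum≤truncatedSum : ∀ {gs bs M} → Pointwise _≤_ gs bs → All (_≤ M) gs → sum gs ≤ truncatedSum M bs
  sum≤truncatedSum []         []          = z≤n
  sum≤truncatedSum (g≤b ∷ gs) (g≤M ∷ gsM) = +-mono-≤ (⊓-glb g≤b g≤M) (sum≤truncatedSum gs gsM)

  truncatedSum-mono : ∀ {M N} xs → M ≤ N → truncatedSum M xs ≤ truncatedSum N xs
  truncatedSum-mono []       _   = z≤n
  truncatedSum-mono (x ∷ xs) M≤N = +-mono-≤ (⊓-monoʳ-≤ x M≤N) (truncatedSum-mono xs M≤N)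

  data Anchored : PSched → Set where
    anchored : ∀ {q st} → Anchored ((0 , q) ∷ st)

  record Invariant (st : PSched) (done : List ℕ) (lo : ℕ) : Set where
    field
      anchor      : Anchored st
      ascending   : StartsAscending st
      gapBounds   : List ℕ
      gaps≤       : Pointwise _≤_ (gaps (pmakespan st) st) gapBounds
      gapBounds↭  : gapBounds ↭ done
      lo≤done     : All (lo ≤_) done
      certificate : PrefixBound (pmakespan st) done

  prefixBound-extend : ∀ {C C' ps} p → C' ≤ C → PrefixBound C ps → PrefixBound C' (ps ++ p ∷ [])
  prefixBound-extend p C'≤C (prefixBound ys q zs refl q≤ys bound) =
    prefixBound ys q (zs ++ p ∷ []) (++-assoc ys (q ∷ zs) (p ∷ [])) q≤ys (≤-trans C'≤C bound)

  delayed-bound : ∀ {C C' x p h T} → x ≤ 2 * p → p ≤ h → C ≤ x + T → C' ≤ C + (2 * p ∸ x) →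
    C' ≤ h ⊓ (2 * p) + T + p
  delayed-bound {C} {C'} {x} {p} {h} {T} x≤2p p≤h C≤ C'≤ = begin
    C'                   ≤⟨ C'≤ ⟩
    C + (2 * p ∸ x)      ≤⟨ +-monoˡ-≤ (2 * p ∸ x) C≤ ⟩
    x + T + (2 * p ∸ x)  ≡⟨ xy∙z≈xz∙y x T (2 * p ∸ x) ⟩
    x + (2 * p ∸ x) + T  ≡⟨ cong (_+ T) (m+[n∸m]≡n x≤2p) ⟩
    p + (p + 0) + T      ≡⟨ cong (λ t → p + t + T) (+-identityʳ p) ⟩
    p + p + T            ≡⟨ xy∙z≈xz∙y p p T ⟩
    p + T + p            ≤⟨ +-monoˡ-≤ p (+-monoˡ-≤ T (⊓-glb p≤h (m≤n*m p 2))) ⟩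
    h ⊓ (2 * p) + T + p  ∎
    where open ≤-Reasoning

  prefixBound-delayed : ∀ {C C' x p h t} → x ≤ 2 * p → All (p ≤_) (h ∷ t) → C ≤ truncatedSum x (h ∷ t) →
    C' ≤ C + (2 * p ∸ x) → PrefixBound C' (h ∷ t ++ p ∷ [])
  prefixBound-delayed {C} {C'} {x} {p} {h} {t} x≤2p p≤done@(p≤h ∷ _) C≤ C'≤ =
    prefixBound (h ∷ t) p [] refl p≤done (delayed-bound x≤2p p≤h C≤x+T C'≤)
    where
    C≤x+T : C ≤ x + truncatedSum (2 * p) t
    C≤x+T = ≤-trans C≤ (+-mono-≤ (m⊓n≤n h x) (truncatedSum-mono t x≤2p))

  module _ {q₀ es h t lo} (I : Invariant ((0 , q₀) ∷ es) (h ∷ t) lo) where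
    open Invariant I

    private
      st = (0 , q₀) ∷ es
      C = pmakespan st

    makespan≤truncatedSum : ∀ {x} → All (_≤ x) (gaps C st) → C ≤ truncatedSum x (h ∷ t)
    makespan≤truncatedSum {x} max = begin
      C                         ≡⟨ sum-gaps 0 q₀ es C ascending (endsBy-pmakespan st) ⟨
      sum (gaps C st) + 0       ≡⟨ +-identityʳ _ ⟩
      sum (gaps C st)           ≤⟨ sum≤truncatedSum gaps≤ max ⟩
      truncatedSum x gapBounds  ≡⟨ sum-↭ (map⁺ (_⊓ x) gapBounds↭) ⟩
      truncatedSum x (h ∷ t)    ∎
      where open ≤-Reasoning

    insert-invariant : ∀ {p i x} → p ≤ lo → gaps C st [ i ]= x → All (_≤ x) (gaps C st) →
      Invariant (insertJob p x i st) (h ∷ t ++ p ∷ []) p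
    insert-invariant {p} {i} {x} p≤lo at max = record
      { anchor      = subst Anchored (sym (proj₂ (insertJob-∷ i (0 , q₀) es))) anchored
      ; ascending   = insert-ascending i st C ascending at
      ; gapBounds   = replace₂ i p b gapBounds
      ; gaps≤       = Pointwise.transitive ≤-trans (insert-gaps i st C C' ends ascending at C'≤)
                        (replace₂-pointwise gaps≤ at ≤-refl (rest≤ x≤b p≤b))
      ; gapBounds↭  = ↭-trans (replace₂-↭ p at-b) (↭-trans (↭-prep p gapBounds↭) (∷↭∷ʳ p (h ∷ t)))
      ; lo≤done     = ++⁺ (All.map (≤-trans p≤lo) lo≤done) (≤-refl ∷ [])
      ; certificate = certificate′
      }
      where
      open Insertion p x
      ends = endsBy-pmakespan st
      C' = pmakespan (insertJob p x i st)
      C'≤ : C' ≤ C + delay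
      C'≤ = pmakespan-least (insert-endsBy i st C ends ascending at)
      b = proj₁ (pointwise-lookup gaps≤ at)
      at-b = proj₁ (proj₂ (pointwise-lookup gaps≤ at))
      x≤b = proj₂ (proj₂ (pointwise-lookup gaps≤ at))
      p≤b : p ≤ b
      p≤b = ≤-trans p≤lo ([]=-All (All-resp-↭ (↭-sym gapBounds↭) lo≤done) at-b)
      certificate′ : PrefixBound C' (h ∷ t ++ p ∷ [])
      certificate′ with ≤-total (2 * p) x
      ... | inj₁ 2p≤x = prefixBound-extend p C'≤C certificate
        where
        C'≤C : C' ≤ C
        C'≤C = ≤-trans C'≤ (≤-reflexive (trans (cong (C +_) (m≤n⇒m∸n≡0 2p≤x)) (+-identityʳ C)))
      ... | inj₂ x≤2p =
        prefixBound-delayed x≤2p (All.map (≤-trans p≤lo) lo≤done) (makespan≤truncatedSum max) C'≤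

  bestGap-gaps-spec : ∀ C e es → let G = gaps C (e ∷ es) ; (i , x) = bestGap G in G [ i ]= x × All (_≤ x) G
  bestGap-gaps-spec C (s , q) []        = bestGap-spec (C ∸ s) []
  bestGap-gaps-spec C (s , q) (e' ∷ es) = bestGap-spec (proj₁ e' ∸ s) (gaps C (e' ∷ es))

  greedyStep-≡ : ∀ e es p → let (i , x) = bestGap (gaps (pmakespan (e ∷ es)) (e ∷ es)) in
    greedyStep (e ∷ es) p ≡ insertJob p x i (e ∷ es)
  greedyStep-≡ e es p with bestGap (gaps (pmakespan (e ∷ es)) (e ∷ es))
  ... | (i , x) = refl

  greedyStep-invariant : ∀ {st h t lo p} → Invariant st (h ∷ t) lo → p ≤ lo →
    Invariant (greedyStep st p) (h ∷ t ++ p ∷ []) p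
  greedyStep-invariant {p = p} I p≤lo with Invariant.anchor I
  ... | anchored {q₀} {es} rewrite greedyStep-≡ (0 , q₀) es p =
    insert-invariant I p≤lo (proj₁ spec) (proj₂ spec)
    where spec = bestGap-gaps-spec (pmakespan ((0 , q₀) ∷ es)) (0 , q₀) es

  greedy-prefixBound-from : ∀ rest {st h t lo} → Invariant st (h ∷ t) lo → NonIncreasing (lo ∷ rest) →
    PrefixBound (pmakespan (foldl greedyStep st rest)) (h ∷ t ++ rest)
  greedy-prefixBound-from [] {t = t} I _ =
    subst (PrefixBound _) (cong (_ ∷_) (sym (++-identityʳ t))) (Invariant.certificate I)
  greedy-prefixBound-from (p ∷ rest) {t = t} I (ni-∷ p≤lo ni) =
    subst (PrefixBound _) (cong (_ ∷_) (++-assoc t (p ∷ []) rest))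
      (greedy-prefixBound-from rest (greedyStep-invariant I p≤lo) ni)

  initial-invariant : ∀ p → Invariant ((0 , p) ∷ []) (p ∷ []) p
  initial-invariant p = record
    { anchor      = anchored
    ; ascending   = [-]
    ; gapBounds   = p ∷ []
    ; gaps≤       = ≤-reflexive (⊔-identityʳ p) ∷ []
    ; gapBounds↭  = ↭-refl
    ; lo≤done     = ≤-refl ∷ []
    ; certificate = prefixBound [] p [] refl [] (≤-reflexive (⊔-identityʳ p))
    }

  greedy-prefixBound : ∀ p ps → NonIncreasing (p ∷ ps) → PrefixBound (greedyMakespan (p ∷ ps)) (p ∷ ps)
  greedy-prefixBound p ps = greedy-prefixBound-from ps (initial-invariant p)

open import Defs
open import Data.List using (length; [])
open import Data.Fin using (Fin)
open import Data.Integer using (+_)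
open import Data.Rational using (ℚ; _≤_; _*_; _/_)
open import Data.Rational.Properties using (≤-refl)
open LowerBound using (≤-three-halves; makespan-lowerBound)
open UpperBound using (greedy-prefixBound)

mainTheorem2 : (p : List ℕ) → NonIncreasing p → AllPositive p →
    (s : Fin (length p) → ℚ) → Feasible p s →
    (+ greedyMakespan p) / 1 ≤ ((+ 3) / 2) * makespan p s
mainTheorem2 [] _ _ _ _ = ≤-refl
mainTheorem2 (p ∷ ps) ni _ s feasible =
  ≤-three-halves (greedyMakespan (p ∷ ps)) (makespan (p ∷ ps) s)
    (makespan-lowerBound (p ∷ ps) s feasible (greedy-prefixBound p ps ni))
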